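{- Let $d\ge2$ and let $q$ be a prime power with $q\equiv1\pmod d$. Then every near-linear orthomorphism $\theta\in\mathscr{D}_d(q)$ is orthogonal to precisely $(q-3d-1)/d$ linear orthomorphisms over $\mathbb{F}_q$.
   Context: Let $\mathbb{F}_q$ be the finite field of order $q$. An orthomorphism is a permutation $\theta$ of $\mathbb{F}_q$ such that $x\mapsto\theta(x)-x$ is also a permutation. Two orthomorphisms $\theta,\theta'$ are orthogonal if $x\mapsto\theta(x)-\theta'(x)$ is a permutation. For $k\mid(q-1)$, fix a generator $g$ of $\mathbb{F}_q^*$ and let $C_{k,i}=\{g^j: j\equiv i\pmod k\}$, $0\le i<k$. A cyclotomic map of index $k$ with multipliers $[a_0,\dots,a_{k-1}]$ is $\theta(0)=0$, $\theta(x)=a_ix$ for $x\in C_{k,i}$. $\mathscr{C}_k(q)$ is the set of orthomorphisms that are cyclotomic maps of index $k$, and $\mathscr{D}_k(q)=\mathscr{C}_k(q)\setminus\bigcup_{\ell<k,\ \ell\mid(q-1)}\mathscr{C}_\ell(q)$. A linear orthomorphism is an element of $\mathscr{C}_1(q)$, i.e. a map $x\mapsto cx$ with $c\in\mathbb{F}_q\setminus\{0,1\}$. An element of $\mathscr{C}_k(q)$ with multipliers $[a_0,\dots,a_{k-1}]$ is near-linear if $a_0\neq a_1=\cdots=a_{k-1}$. -}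

module Defs where

open import Level using (0ℓ)
open import Data.Nat using (ℕ; zero; suc; _<_; _≤_; NonZero)
  renaming (_^_ to _^ℕ_)
open import Data.Nat.DivMod using (_%_)
open import Data.Nat.Divisibility using (_∣_)
open import Data.Nat.Primality using (Prime)
open import Data.Fin using (Fin)
open import Data.Product using (Σ; ∃; _×_; ∃-syntax)
open import Data.List using (List; length)
open import Data.List.Membership.Propositional using (_∈_)
open import Data.List.Relation.Unary.Unique.Propositional using (Unique)
open import Function.Bundles using (_↔_; _⇔_)
open import Function.Definitions using (Bijective)
open import Relation.Binary.PropositionalEquality using (_≡_; _≢_)
open import Relation.Nullary using (¬_)
open import Algebra.Structures using (IsCommutativeRing)

IsPrimePower : ℕ → Set
IsPrimePower q = ∃[ p ] ∃[ k ] (Prime p × q ≡ p ^ℕ suc k)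

record FiniteField (q : ℕ) : Set₁ where
  infixl 6 _+_ _-_
  infixl 7 _*_
  infix  8 -_
  field
    Carrier : Set
    _+_ _*_ : Carrier → Carrier → Carrier
    -_      : Carrier → Carrier
    0# 1#   : Carrier
    isCommutativeRing : IsCommutativeRing _≡_ _+_ _*_ -_ 0# 1#
    0≢1     : 0# ≢ 1#
    inverse : ∀ x → x ≢ 0# → ∃[ y ] (x * y ≡ 1#)
    card    : Carrier ↔ Fin q

  _-_ : Carrier → Carrier → Carrier
  x - y = x + (- y)

  _^_ : Carrier → ℕ → Carrier
  x ^ zero  = 1#
  x ^ suc n = x * (x ^ n)

  IsGenerator : Carrier → Set
  IsGenerator g = g ≢ 0# × (∀ x → x ≢ 0# → ∃[ j ] (g ^ j ≡ x))

  IsPermutation : (Carrier → Carrier) → Set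
  IsPermutation f = Bijective _≡_ _≡_ f

  IsOrthomorphism : (Carrier → Carrier) → Set
  IsOrthomorphism θ = IsPermutation θ × IsPermutation (λ x → θ x - x)

  Orthogonal : (Carrier → Carrier) → (Carrier → Carrier) → Set
  Orthogonal θ θ' = IsPermutation (λ x → θ x - θ' x)

  -- θ is the cyclotomic map of index k (w.r.t. generator g) with multipliers
  -- a 0, …, a (k-1)  (only the values a i for i < k matter):
  -- θ 0 = 0 and θ x = a i * x for x ∈ C_{k,i} = { g^j : j ≡ i mod k }.
  IsCyclotomicMap : (k : ℕ) .{{_ : NonZero k}} → Carrier → (ℕ → Carrier)
                    → (Carrier → Carrier) → Set
  IsCyclotomicMap k g a θ =
    θ 0# ≡ 0# × (∀ j → θ (g ^ j) ≡ a (j % k) * (g ^ j))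

  InC : (k : ℕ) .{{_ : NonZero k}} → Carrier → (Carrier → Carrier) → Set
  InC k g θ = IsOrthomorphism θ × ∃[ a ] IsCyclotomicMap k g a θ

  InD : (k : ℕ) .{{_ : NonZero k}} → Carrier → (Carrier → Carrier) → Set
  InD k g θ = InC k g θ ×
    (∀ ℓ .{{_ : NonZero ℓ}} → ℓ < k → ℓ ∣ Data.Nat._∸_ q 1 → ¬ InC ℓ g θ)

  NearLinear : (k : ℕ) .{{_ : NonZero k}} → Carrier → (Carrier → Carrier) → Set
  NearLinear k g θ = ∃[ a ] (IsCyclotomicMap k g a θ × a 0 ≢ a 1 ×
                       (∀ i → 1 ≤ i → i < k → a i ≡ a 1))

  linear : Carrier → Carrier → Carrier
  linear c x = c * x

  ListsOrthogonalLinear : (Carrier → Carrier) → List Carrier → Set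
  ListsOrthogonalLinear θ L =
    Unique L × (∀ c → c ∈ L ⇔ (c ≢ 0# × c ≢ 1# × Orthogonal θ (linear c)))

module Submission where

-- For c ∈ F, the map θ - c·id is again a near-linear cyclotomic map, with multipliers a_i - c.
-- A near-linear cyclotomic map with multipliers b₀, b₁ is a permutation iff b₁ ≠ 0 and
-- b₀/b₁ lies in the subgroup H of d-th powers, so θ is orthogonal to x ↦ c x iff
-- (a₀ - c)/(a₁ - c) ∈ H. The Möbius map c ↦ (a₀ - c)/(a₁ - c) is a bijection from
-- F ∖ {a₁} to F ∖ {1}, and the values it takes at c = 0 and c = 1 lie in H because θ and
-- θ - id are permutations. So the admissible c correspond to H ∖ {1, y₀, y₁}, which has
-- (q - 1)/d - 3 elements.

open import Level using (0ℓ)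
open import Defs
open import Data.Nat as ℕ using (ℕ; zero; suc; NonZero; z≤n; s≤s; _<_; _≤_; _%_; _/_; _∸_)
import Data.Nat.Properties as ℕ
open import Data.Nat.DivMod using (m≡m%n+[m/n]*n; m%n<n; m<n⇒m%n≡m; [m+kn]%n≡m%n; m∣n⇒o%n%m≡o%m)
open import Data.Nat.Divisibility using (_∣_; quotient)
open import Data.Fin as Fin using (Fin; toℕ; fromℕ<; punchIn; punchOut)
open import Data.Fin.Properties using (¬Fin0; pigeonhole; injective⇒≤; punchIn-injective; punchInᵢ≢i; punchOut-injective; toℕ-fromℕ<; toℕ≤pred[n])
open import Data.Product using (∃-syntax; _×_; _,_; proj₁; proj₂)
open import Data.Sum using (_⊎_; inj₁; inj₂)
open import Data.Empty using (⊥-elim)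
open import Relation.Nullary using (¬_; yes; no; contradiction; ¬?)
open import Relation.Nullary.Decidable using (map′)
open import Relation.Binary.PropositionalEquality
open import Relation.Binary.Definitions using (DecidableEquality; tri<; tri≈; tri>)
open import Function.Bundles using (_⇔_; mk⇔; Equivalence; Inverse; Injection)
open import Function.Base using (_∘_)
open import Function.Definitions using (Injective)
open import Function.Properties.Inverse using (↔⇒↣)
open import Function.Consequences.Propositional using (strictlySurjective⇒surjective)
open import Algebra.Bundles using (CommutativeRing)
open import Algebra.Structures using (IsCommutativeRing)
open import Data.List using (List; []; _∷_; length; filter; map; applyUpTo)
open import Data.List.Properties using (filter-all; filter-accept; filter-reject; length-map; length-applyUpTo)
import Data.List.Relation.Unary.All as All
import Data.List.Relation.Unary.All.Properties as All
open import Data.List.Relation.Unary.AllPairs using ([]; _∷_)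
open import Data.List.Relation.Unary.Any using (here; there)
open import Data.List.Membership.Propositional using (_∈_)
open import Data.List.Membership.Propositional.Properties using (∈-filter⁺; ∈-filter⁻; ∈-map⁺; ∈-map⁻; ∈-applyUpTo⁺; ∈-applyUpTo⁻)
open import Data.List.Relation.Unary.Unique.Propositional using (Unique)
import Data.List.Relation.Unary.Unique.Propositional.Properties as Unique
open ≡-Reasoning

module FieldProperties {q : ℕ} (F : FiniteField q) where
  open FiniteField F public
  open IsCommutativeRing isCommutativeRing public
    using (+-comm; +-identityʳ; -‿inverseʳ; *-assoc; *-comm; *-identityˡ; *-identityʳ; zeroˡ; zeroʳ)

  commutativeRing : CommutativeRing 0ℓ 0ℓ
  commutativeRing = record { isCommutativeRing = isCommutativeRing }

  open import Algebra.Properties.Ring (CommutativeRing.ring commutativeRing) public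
    using ([y-z]x≈yx-zx; x[y-z]≈xy-xz)
  open import Algebra.Properties.AbelianGroup (CommutativeRing.+-abelianGroup commutativeRing) public
    using (x∙y⁻¹≈ε⇒x≈y; x≈y⇒x∙y⁻¹≈ε; ⁻¹-anti-homo‿-; ε⁻¹≈ε)
  open import Algebra.Properties.CommutativeSemigroup (CommutativeRing.+-commutativeSemigroup commutativeRing) public
    using (interchange)

  index : Carrier → Fin q
  index = Inverse.to card

  index-injective : Injective _≡_ _≡_ index
  index-injective = Injection.injective (↔⇒↣ card)

  infix 4 _≟_
  _≟_ : DecidableEquality Carrier
  x ≟ y = map′ index-injective (cong index) (index x Fin.≟ index y)

  1≢0 : 1# ≢ 0#
  1≢0 = ≢-sym 0≢1

  x-y≡0⇒x≡y : ∀ {x y} → x - y ≡ 0# → x ≡ y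
  x-y≡0⇒x≡y = x∙y⁻¹≈ε⇒x≈y _ _

  x-0≡x : ∀ x → x - 0# ≡ x
  x-0≡x x = trans (cong (x +_) ε⁻¹≈ε) (+-identityʳ x)

  [x-y]-[z-w]≡[x-z]-[y-w] : ∀ x y z w → (x - y) - (z - w) ≡ (x - z) - (y - w)
  [x-y]-[z-w]≡[x-z]-[y-w] x y z w = begin
    (x - y) - (z - w)         ≡⟨ cong ((x - y) +_) (⁻¹-anti-homo‿- z w) ⟩
    (x - y) + (w - z)         ≡⟨ interchange x (- y) w (- z) ⟩
    (x + w) + (- y + - z)     ≡⟨ cong ((x + w) +_) (+-comm (- y) (- z)) ⟩
    (x + w) + (- z + - y)     ≡⟨ interchange x (- z) w (- y) ⟨
    (x - z) + (w - y)         ≡⟨ cong ((x - z) +_) (⁻¹-anti-homo‿- y w) ⟨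
    (x - z) - (y - w)         ∎

  inv : Carrier → Carrier
  inv x with x ≟ 0#
  ... | yes _  = 0#
  ... | no x≢0 = proj₁ (inverse x x≢0)

  inv[x]*x≡1 : ∀ {x} → x ≢ 0# → inv x * x ≡ 1#
  inv[x]*x≡1 {x} x≢0 with x ≟ 0#
  ... | yes x≡0 = contradiction x≡0 x≢0
  ... | no x≢0′ = trans (*-comm _ x) (proj₂ (inverse x x≢0′))

  inv[x]≢0 : ∀ {x} → x ≢ 0# → inv x ≢ 0#
  inv[x]≢0 {x} x≢0 inv≡0 = 1≢0 (trans (sym (inv[x]*x≡1 x≢0)) (trans (cong (_* x) inv≡0) (zeroˡ x)))

  x*[y*inv[x]]≡y : ∀ {x} y → x ≢ 0# → x * (y * inv x) ≡ y
  x*[y*inv[x]]≡y {x} y x≢0 = begin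
    x * (y * inv x)   ≡⟨ cong (x *_) (*-comm y (inv x)) ⟩
    x * (inv x * y)   ≡⟨ *-assoc x (inv x) y ⟨
    (x * inv x) * y   ≡⟨ cong (_* y) (trans (*-comm x (inv x)) (inv[x]*x≡1 x≢0)) ⟩
    1# * y            ≡⟨ *-identityˡ y ⟩
    y                 ∎

  *-cancelˡ : ∀ {x y z} → x ≢ 0# → x * y ≡ x * z → y ≡ z
  *-cancelˡ {x} {y} {z} x≢0 xy≡xz = begin
    y                 ≡⟨ *-identityˡ y ⟨
    1# * y            ≡⟨ cong (_* y) (inv[x]*x≡1 x≢0) ⟨
    (inv x * x) * y   ≡⟨ *-assoc (inv x) x y ⟩
    inv x * (x * y)   ≡⟨ cong (inv x *_) xy≡xz ⟩
    inv x * (x * z)   ≡⟨ *-assoc (inv x) x z ⟨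
    (inv x * x) * z   ≡⟨ cong (_* z) (inv[x]*x≡1 x≢0) ⟩
    1# * z            ≡⟨ *-identityˡ z ⟩
    z                 ∎

  *-cancelʳ : ∀ {x y z} → x ≢ 0# → y * x ≡ z * x → y ≡ z
  *-cancelʳ {x} {y} {z} x≢0 yx≡zx = *-cancelˡ x≢0 (trans (*-comm x y) (trans yx≡zx (*-comm z x)))

  x≢0∧y≢0⇒xy≢0 : ∀ {x y} → x ≢ 0# → y ≢ 0# → x * y ≢ 0#
  x≢0∧y≢0⇒xy≢0 {x} x≢0 y≢0 xy≡0 = y≢0 (*-cancelˡ x≢0 (trans xy≡0 (sym (zeroʳ x))))

  ^-+ : ∀ x m k → x ^ (m ℕ.+ k) ≡ x ^ m * x ^ k
  ^-+ x zero    k = sym (*-identityˡ _)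
  ^-+ x (suc m) k = trans (cong (x *_) (^-+ x m k)) (sym (*-assoc _ _ _))

  ^-* : ∀ x m k → x ^ (k ℕ.* m) ≡ (x ^ m) ^ k
  ^-* x m zero    = refl
  ^-* x m (suc k) = trans (^-+ x m (k ℕ.* m)) (cong (x ^ m *_) (^-* x m k))

  1^k≡1 : ∀ k → 1# ^ k ≡ 1#
  1^k≡1 zero    = refl
  1^k≡1 (suc k) = trans (*-identityˡ _) (1^k≡1 k)

  x^k≢0 : ∀ {x} → x ≢ 0# → ∀ k → x ^ k ≢ 0#
  x^k≢0 x≢0 zero    = 1≢0
  x^k≢0 x≢0 (suc k) = x≢0∧y≢0⇒xy≢0 x≢0 (x^k≢0 x≢0 k)

  ^-periodic : ∀ {x m} → x ^ m ≡ 1# → ∀ i k → x ^ (i ℕ.+ k ℕ.* m) ≡ x ^ i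
  ^-periodic {x} {m} x^m≡1 i k = begin
    x ^ (i ℕ.+ k ℕ.* m)     ≡⟨ ^-+ x i (k ℕ.* m) ⟩
    x ^ i * x ^ (k ℕ.* m)   ≡⟨ cong (x ^ i *_) (^-* x m k) ⟩
    x ^ i * (x ^ m) ^ k     ≡⟨ cong (λ u → x ^ i * u ^ k) x^m≡1 ⟩
    x ^ i * 1# ^ k          ≡⟨ cong (x ^ i *_) (1^k≡1 k) ⟩
    x ^ i * 1#              ≡⟨ *-identityʳ _ ⟩
    x ^ i                   ∎

  ^-% : ∀ {x m} .{{_ : NonZero m}} → x ^ m ≡ 1# → ∀ i → x ^ i ≡ x ^ (i % m)
  ^-% {x} {m} x^m≡1 i = begin
    x ^ i                         ≡⟨ cong (x ^_) (m≡m%n+[m/n]*n i m) ⟩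
    x ^ (i % m ℕ.+ (i / m) ℕ.* m) ≡⟨ ^-periodic x^m≡1 (i % m) (i / m) ⟩
    x ^ (i % m)                   ∎

  x^i≡x^j⇒x^[j∸i]≡1 : ∀ {x i j} → x ≢ 0# → i ≤ j → x ^ i ≡ x ^ j → x ^ (j ∸ i) ≡ 1#
  x^i≡x^j⇒x^[j∸i]≡1 {x} {i} {j} x≢0 i≤j x^i≡x^j = sym (*-cancelˡ (x^k≢0 x≢0 i) (begin
    x ^ i * 1#              ≡⟨ *-identityʳ _ ⟩
    x ^ i                   ≡⟨ x^i≡x^j ⟩
    x ^ j                   ≡⟨ cong (x ^_) (ℕ.m+[n∸m]≡n i≤j) ⟨
    x ^ (i ℕ.+ (j ∸ i))     ≡⟨ ^-+ x i (j ∸ i) ⟩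
    x ^ i * x ^ (j ∸ i)     ∎))

  permutation-resp-≗ : ∀ {f h} → f ≗ h → IsPermutation f → IsPermutation h
  permutation-resp-≗ f≗h (f-injective , f-surjective) =
    (λ {x} {y} hx≡hy → f-injective (trans (f≗h x) (trans hx≡hy (sym (f≗h y))))) ,
    (λ y → let (x , fx≡y) = f-surjective y in x , λ {z} z≡x → trans (sym (f≗h z)) (fx≡y z≡x))

module GeneratorPowers {n : ℕ} (F : FiniteField (suc n)) {g : FiniteField.Carrier F}
                       (g-generator : FiniteField.IsGenerator F g) where
  open FieldProperties F

  g≢0 : g ≢ 0#
  g≢0 = proj₁ g-generator

  log : ∀ x → x ≢ 0# → ∃[ j ] (g ^ j ≡ x)
  log = proj₂ g-generator

  g^k≢0 : ∀ k → g ^ k ≢ 0#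
  g^k≢0 = x^k≢0 g≢0

  nonzeroIndex : ∀ {x} → x ≢ 0# → Fin n
  nonzeroIndex x≢0 = punchOut (x≢0 ∘ index-injective ∘ sym)

  nonzeroIndex-injective : ∀ {x y} (x≢0 : x ≢ 0#) (y≢0 : y ≢ 0#) →
                           nonzeroIndex x≢0 ≡ nonzeroIndex y≢0 → x ≡ y
  nonzeroIndex-injective x≢0 y≢0 =
    index-injective ∘ punchOut-injective (x≢0 ∘ index-injective ∘ sym) (y≢0 ∘ index-injective ∘ sym)

  nonzero : Fin n → Carrier
  nonzero i = Inverse.from card (punchIn (index 0#) i)

  index-nonzero : ∀ i → index (nonzero i) ≡ punchIn (index 0#) i
  index-nonzero i = Inverse.strictlyInverseˡ card _

  nonzero≢0 : ∀ i → nonzero i ≢ 0#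
  nonzero≢0 i i≡0 = punchInᵢ≢i _ i (trans (sym (index-nonzero i)) (cong index i≡0))

  nonzero-injective : Injective _≡_ _≡_ nonzero
  nonzero-injective {i} {j} e =
    punchIn-injective _ i j (trans (sym (index-nonzero i)) (trans (cong index e) (index-nonzero j)))

  -- Every nonzero element is some g^j with j < m, so i ↦ (log of nonzero i) mod m is injective.
  g^m≡1⇒n≤m : ∀ {m} → 0 < m → g ^ m ≡ 1# → n ≤ m
  g^m≡1⇒n≤m {m} 0<m g^m≡1 = injective⇒≤ residue-injective
    where
    instance
      m-nonZero : NonZero m
      m-nonZero = ℕ.>-nonZero 0<m
    exponent : Fin n → ℕ
    exponent i = proj₁ (log (nonzero i) (nonzero≢0 i))
    g^exponent : ∀ i → g ^ exponent i ≡ nonzero i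
    g^exponent i = proj₂ (log (nonzero i) (nonzero≢0 i))
    residue : Fin n → Fin m
    residue i = fromℕ< (m%n<n (exponent i) m)
    residue-injective : Injective _≡_ _≡_ residue
    residue-injective {i} {j} e = nonzero-injective (begin
      nonzero i              ≡⟨ g^exponent i ⟨
      g ^ exponent i         ≡⟨ ^-% g^m≡1 (exponent i) ⟩
      g ^ (exponent i % m)   ≡⟨ cong (g ^_) (trans (sym (toℕ-fromℕ< _)) (trans (cong toℕ e) (toℕ-fromℕ< _))) ⟩
      g ^ (exponent j % m)   ≡⟨ ^-% g^m≡1 (exponent j) ⟨
      g ^ exponent j         ≡⟨ g^exponent j ⟩
      nonzero j              ∎)

  -- Pigeonhole: two of g^0, …, g^n have the same index among the n nonzero elements.
  ∃g^k≡1 : ∃[ k ] (0 < k × k ≤ n × g ^ k ≡ 1#)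
  ∃g^k≡1 with i , j , i<j , same ← pigeonhole (ℕ.n<1+n n) (λ i → nonzeroIndex (g^k≢0 (toℕ i)))
    = toℕ j ∸ toℕ i , ℕ.m<n⇒0<n∸m i<j ,
      ℕ.≤-trans (ℕ.m∸n≤m (toℕ j) (toℕ i)) (toℕ≤pred[n] j) ,
      x^i≡x^j⇒x^[j∸i]≡1 g≢0 (ℕ.<⇒≤ i<j) (nonzeroIndex-injective (g^k≢0 (toℕ i)) (g^k≢0 (toℕ j)) same)

  0<n : 0 < n
  0<n = let (_ , 0<k , k≤n , _) = ∃g^k≡1 in ℕ.<-≤-trans 0<k k≤n

  instance
    n-nonZero : NonZero n
    n-nonZero = ℕ.>-nonZero 0<n

  g^n≡1 : g ^ n ≡ 1#
  g^n≡1 with k , 0<k , k≤n , g^k≡1 ← ∃g^k≡1 =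
    subst (λ m → g ^ m ≡ 1#) (ℕ.≤-antisym k≤n (g^m≡1⇒n≤m 0<k g^k≡1)) g^k≡1

  g^i≢g^j : ∀ {i j} → i < j → j < n → g ^ i ≢ g ^ j
  g^i≢g^j {i} {j} i<j j<n g^i≡g^j = ℕ.<⇒≱ (ℕ.≤-<-trans (ℕ.m∸n≤m j i) j<n)
    (g^m≡1⇒n≤m (ℕ.m<n⇒0<n∸m i<j) (x^i≡x^j⇒x^[j∸i]≡1 g≢0 (ℕ.<⇒≤ i<j) g^i≡g^j))

  ^-injective-% : ∀ {i j} → g ^ i ≡ g ^ j → i % n ≡ j % n
  ^-injective-% {i} {j} g^i≡g^j with ℕ.<-cmp (i % n) (j % n)
  ... | tri< i<j _ _ = contradiction (trans (sym (^-% g^n≡1 i)) (trans g^i≡g^j (^-% g^n≡1 j)))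
                                     (g^i≢g^j i<j (m%n<n j n))
  ... | tri≈ _ i≡j _ = i≡j
  ... | tri> _ _ j<i = contradiction (trans (sym (^-% g^n≡1 j)) (trans (sym g^i≡g^j) (^-% g^n≡1 i)))
                                     (g^i≢g^j j<i (m%n<n i n))

  ^-injective-%-divisor : ∀ {d} .{{_ : NonZero d}} → d ∣ n → ∀ {i j} → g ^ i ≡ g ^ j → i % d ≡ j % d
  ^-injective-%-divisor {d} d∣n {i} {j} g^i≡g^j = begin
    i % d        ≡⟨ m∣n⇒o%n%m≡o%m d n i d∣n ⟨
    i % n % d    ≡⟨ cong (_% d) (^-injective-% g^i≡g^j) ⟩
    j % n % d    ≡⟨ m∣n⇒o%n%m≡o%m d n j d∣n ⟩
    j % d        ∎

module NearLinearPermutation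
    {n : ℕ} (F : FiniteField (suc n)) {g : FiniteField.Carrier F}
    (g-generator : FiniteField.IsGenerator F g)
    {d : ℕ} .{{_ : NonZero d}} (1<d : 1 < d) (d∣n : d ∣ n)
    {b : ℕ → FiniteField.Carrier F} {ψ : FiniteField.Carrier F → FiniteField.Carrier F}
    (ψ-cyclotomic : FiniteField.IsCyclotomicMap F d g b ψ)
    (b-nearLinear : ∀ i → 1 ≤ i → i < d → b i ≡ b 1) where
  open FieldProperties F
  open GeneratorPowers F g-generator

  ψ0≡0 : ψ 0# ≡ 0#
  ψ0≡0 = proj₁ ψ-cyclotomic

  ψ-power : ∀ j → ψ (g ^ j) ≡ b (j % d) * g ^ j
  ψ-power = proj₂ ψ-cyclotomic

  0%d≡0 : 0 % d ≡ 0
  0%d≡0 = m<n⇒m%n≡m (ℕ.<-trans (s≤s z≤n) 1<d)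

  ψ1≡b0 : ψ 1# ≡ b 0
  ψ1≡b0 = trans (ψ-power 0) (trans (cong (λ i → b i * 1#) 0%d≡0) (*-identityʳ (b 0)))

  multiplier-dichotomy : ∀ j → j % d ≡ 0 ⊎ b (j % d) ≡ b 1
  multiplier-dichotomy j with j % d ℕ.≟ 0
  ... | yes j%d≡0 = inj₁ j%d≡0
  ... | no  j%d≢0 = inj₂ (b-nearLinear _ (ℕ.n≢0⇒n>0 j%d≢0) (m%n<n j d))

  permutation⇒ : IsPermutation ψ → b 1 ≢ 0# × ∃[ t ] b 0 ≡ b 1 * g ^ (t ℕ.* d)
  permutation⇒ (ψ-injective , _) = b1≢0 , s / d , (begin
    b 0                       ≡⟨ b1*g^s≡b0 ⟨
    b 1 * g ^ s               ≡⟨ cong (λ e → b 1 * g ^ e) (trans (m≡m%n+[m/n]*n s d) (cong (ℕ._+ s / d ℕ.* d) s%d≡0)) ⟩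
    b 1 * g ^ (s / d ℕ.* d)   ∎)
    where
    ψ≢0 : ∀ {x} → x ≢ 0# → ψ x ≢ 0#
    ψ≢0 x≢0 ψx≡0 = x≢0 (ψ-injective (trans ψx≡0 (sym ψ0≡0)))
    b1≢0 : b 1 ≢ 0#
    b1≢0 b1≡0 = ψ≢0 (g^k≢0 1) (begin
      ψ (g ^ 1)           ≡⟨ ψ-power 1 ⟩
      b (1 % d) * g ^ 1   ≡⟨ cong (λ i → b i * g ^ 1) (m<n⇒m%n≡m 1<d) ⟩
      b 1 * g ^ 1         ≡⟨ cong (_* g ^ 1) b1≡0 ⟩
      0# * g ^ 1          ≡⟨ zeroˡ _ ⟩
      0#                  ∎)
    b0≢0 : b 0 ≢ 0#
    b0≢0 b0≡0 = ψ≢0 1≢0 (trans ψ1≡b0 b0≡0)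
    s : ℕ
    s = proj₁ (log (b 0 * inv (b 1)) (x≢0∧y≢0⇒xy≢0 b0≢0 (inv[x]≢0 b1≢0)))
    b1*g^s≡b0 : b 1 * g ^ s ≡ b 0
    b1*g^s≡b0 = trans (cong (b 1 *_) (proj₂ (log _ _))) (x*[y*inv[x]]≡y (b 0) b1≢0)
    s%d≡0 : s % d ≡ 0
    s%d≡0 with multiplier-dichotomy s
    ... | inj₁ s%d≡0 = s%d≡0
    ... | inj₂ bs≡b1 = trans (^-injective-%-divisor d∣n {s} {0} (ψ-injective (begin
      ψ (g ^ s)           ≡⟨ ψ-power s ⟩
      b (s % d) * g ^ s   ≡⟨ cong (_* g ^ s) bs≡b1 ⟩
      b 1 * g ^ s         ≡⟨ b1*g^s≡b0 ⟩
      b 0                 ≡⟨ ψ1≡b0 ⟨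
      ψ (g ^ 0)           ∎))) 0%d≡0

  module _ (b1≢0 : b 1 ≢ 0#) {t : ℕ} (b0≡b1*g^td : b 0 ≡ b 1 * g ^ (t ℕ.* d)) where

    b0*g^j≡b1*g^[j+td] : ∀ j → b 0 * g ^ j ≡ b 1 * g ^ (j ℕ.+ t ℕ.* d)
    b0*g^j≡b1*g^[j+td] j = begin
      b 0 * g ^ j                     ≡⟨ cong (_* g ^ j) b0≡b1*g^td ⟩
      (b 1 * g ^ (t ℕ.* d)) * g ^ j   ≡⟨ *-assoc (b 1) _ _ ⟩
      b 1 * (g ^ (t ℕ.* d) * g ^ j)   ≡⟨ cong (b 1 *_) (*-comm _ (g ^ j)) ⟩
      b 1 * (g ^ j * g ^ (t ℕ.* d))   ≡⟨ cong (b 1 *_) (^-+ g j (t ℕ.* d)) ⟨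
      b 1 * g ^ (j ℕ.+ t ℕ.* d)       ∎

    b0≢0 : b 0 ≢ 0#
    b0≢0 b0≡0 = x≢0∧y≢0⇒xy≢0 b1≢0 (g^k≢0 (t ℕ.* d)) (trans (sym b0≡b1*g^td) b0≡0)

    ψ-power-normalForm : ∀ j → ∃[ k ] (k % d ≡ j % d × ψ (g ^ j) ≡ b 1 * g ^ k)
    ψ-power-normalForm j with multiplier-dichotomy j
    ... | inj₁ j%d≡0 = j ℕ.+ t ℕ.* d , [m+kn]%n≡m%n j t d ,
                       trans (ψ-power j) (trans (cong (λ i → b i * g ^ j) j%d≡0) (b0*g^j≡b1*g^[j+td] j))
    ... | inj₂ bj≡b1 = j , refl , trans (ψ-power j) (cong (_* g ^ j) bj≡b1)

    ψ-power≢0 : ∀ j → ψ (g ^ j) ≢ 0#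
    ψ-power≢0 j ψ≡0 = let (k , _ , ψ≡b1*g^k) = ψ-power-normalForm j in
      x≢0∧y≢0⇒xy≢0 b1≢0 (g^k≢0 k) (trans (sym ψ≡b1*g^k) ψ≡0)

    ψ≡0⇒≡0 : ∀ {x} → ψ x ≡ 0# → x ≡ 0#
    ψ≡0⇒≡0 {x} ψx≡0 with x ≟ 0#
    ... | yes x≡0 = x≡0
    ... | no  x≢0 = let (j , g^j≡x) = log x x≢0 in
      contradiction (trans (cong ψ g^j≡x) ψx≡0) (ψ-power≢0 j)

    ψ-power-injective : ∀ i j → ψ (g ^ i) ≡ ψ (g ^ j) → g ^ i ≡ g ^ j
    ψ-power-injective i j ψi≡ψj = *-cancelˡ (bj≢0 i) (begin
      b (i % d) * g ^ i   ≡⟨ ψ-power i ⟨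
      ψ (g ^ i)           ≡⟨ ψi≡ψj ⟩
      ψ (g ^ j)           ≡⟨ ψ-power j ⟩
      b (j % d) * g ^ j   ≡⟨ cong (λ r → b r * g ^ j) i%d≡j%d ⟨
      b (i % d) * g ^ j   ∎)
      where
      bj≢0 : ∀ j → b (j % d) ≢ 0#
      bj≢0 j b≡0 = ψ-power≢0 j (trans (ψ-power j) (trans (cong (_* g ^ j) b≡0) (zeroˡ _)))
      i%d≡j%d : i % d ≡ j % d
      i%d≡j%d with ki , ki%d≡i%d , ψi≡b1*g^ki ← ψ-power-normalForm i
                 | kj , kj%d≡j%d , ψj≡b1*g^kj ← ψ-power-normalForm j =
        trans (sym ki%d≡i%d) (trans (^-injective-%-divisor d∣n (*-cancelˡ b1≢0
          (trans (sym ψi≡b1*g^ki) (trans ψi≡ψj ψj≡b1*g^kj)))) kj%d≡j%d)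

    ψ-injective : Injective _≡_ _≡_ ψ
    ψ-injective {x} {y} ψx≡ψy with x ≟ 0# | y ≟ 0#
    ... | yes x≡0 | _       = trans x≡0 (sym (ψ≡0⇒≡0 (trans (sym ψx≡ψy) (trans (cong ψ x≡0) ψ0≡0))))
    ... | no _    | yes y≡0 = trans (ψ≡0⇒≡0 (trans ψx≡ψy (trans (cong ψ y≡0) ψ0≡0))) (sym y≡0)
    ... | no x≢0  | no y≢0  with i , g^i≡x ← log x x≢0 | j , g^j≡y ← log y y≢0 =
      trans (sym g^i≡x) (trans (ψ-power-injective i j (subst₂ (λ u v → ψ u ≡ ψ v) (sym g^i≡x) (sym g^j≡y) ψx≡ψy)) g^j≡y)

    b0*g^k∈image : ∀ k → ∃[ x ] ψ x ≡ b 0 * g ^ k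
    b0*g^k∈image k with multiplier-dichotomy k
    ... | inj₁ k%d≡0 = g ^ k , trans (ψ-power k) (cong (λ i → b i * g ^ k) k%d≡0)
    ... | inj₂ bk≡b1 = g ^ (k ℕ.+ t ℕ.* d) , (begin
      ψ (g ^ (k ℕ.+ t ℕ.* d))                           ≡⟨ ψ-power _ ⟩
      b ((k ℕ.+ t ℕ.* d) % d) * g ^ (k ℕ.+ t ℕ.* d)     ≡⟨ cong (λ i → b i * g ^ (k ℕ.+ t ℕ.* d)) ([m+kn]%n≡m%n k t d) ⟩
      b (k % d) * g ^ (k ℕ.+ t ℕ.* d)                   ≡⟨ cong (_* g ^ (k ℕ.+ t ℕ.* d)) bk≡b1 ⟩
      b 1 * g ^ (k ℕ.+ t ℕ.* d)                         ≡⟨ b0*g^j≡b1*g^[j+td] k ⟨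
      b 0 * g ^ k                                       ∎)

    ψ-strictlySurjective : ∀ y → ∃[ x ] ψ x ≡ y
    ψ-strictlySurjective y with y ≟ 0#
    ... | yes y≡0 = 0# , trans ψ0≡0 (sym y≡0)
    ... | no  y≢0 =
      let (k , g^k≡y*inv[b0]) = log (y * inv (b 0)) (x≢0∧y≢0⇒xy≢0 y≢0 (inv[x]≢0 b0≢0))
          (x , ψx≡b0*g^k)     = b0*g^k∈image k
      in x , trans ψx≡b0*g^k (trans (cong (b 0 *_) g^k≡y*inv[b0]) (x*[y*inv[x]]≡y y b0≢0))

  permutation⇔ : IsPermutation ψ ⇔ (b 1 ≢ 0# × ∃[ t ] b 0 ≡ b 1 * g ^ (t ℕ.* d))
  permutation⇔ = mk⇔ permutation⇒ λ (b1≢0 , t , b0≡b1*g^td) →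
    ψ-injective b1≢0 {t} b0≡b1*g^td ,
    strictlySurjective⇒surjective (ψ-strictlySurjective b1≢0 {t} b0≡b1*g^td)

module RatioParametrisation {q : ℕ} (F : FiniteField q) {a₀ a₁ : FiniteField.Carrier F}
                            (a₀≢a₁ : a₀ ≢ a₁) where
  open FieldProperties F

  -- (a₀ - c)/(a₁ - c) = y, stated without division
  HasRatio : Carrier → Carrier → Set
  HasRatio c y = a₀ - c ≡ (a₁ - c) * y

  ratio-difference : ∀ c y → (a₀ - c) - (a₁ - c) * y ≡ (a₀ - a₁ * y) - c * (1# - y)
  ratio-difference c y = begin
    (a₀ - c) - (a₁ - c) * y         ≡⟨ cong (λ u → (a₀ - c) - u) ([y-z]x≈yx-zx y a₁ c) ⟩
    (a₀ - c) - (a₁ * y - c * y)     ≡⟨ [x-y]-[z-w]≡[x-z]-[y-w] a₀ c (a₁ * y) (c * y) ⟩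
    (a₀ - a₁ * y) - (c - c * y)     ≡⟨ cong (λ u → (a₀ - a₁ * y) - (u - c * y)) (*-identityʳ c) ⟨
    (a₀ - a₁ * y) - (c * 1# - c * y) ≡⟨ cong (λ u → (a₀ - a₁ * y) - u) (x[y-z]≈xy-xz c 1# y) ⟨
    (a₀ - a₁ * y) - c * (1# - y)    ∎

  hasRatio⇔ : ∀ {c y} → HasRatio c y ⇔ a₀ - a₁ * y ≡ c * (1# - y)
  hasRatio⇔ {c} {y} = mk⇔
    (λ h → x-y≡0⇒x≡y (trans (sym (ratio-difference c y)) (x≈y⇒x∙y⁻¹≈ε h)))
    (λ h → x-y≡0⇒x≡y (trans (ratio-difference c y) (x≈y⇒x∙y⁻¹≈ε h)))

  ¬HasRatio-1 : ∀ {c} → ¬ HasRatio c 1#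
  ¬HasRatio-1 {c} h = a₀≢a₁ (begin
    a₀             ≡⟨ x-y≡0⇒x≡y (trans (Equivalence.to hasRatio⇔ h) (trans (cong (c *_) (-‿inverseʳ 1#)) (zeroʳ c))) ⟩
    a₁ * 1#        ≡⟨ *-identityʳ a₁ ⟩
    a₁             ∎)

  a₁-c≢0 : ∀ {c y} → HasRatio c y → a₁ - c ≢ 0#
  a₁-c≢0 {c} {y} h a₁-c≡0 = a₀≢a₁ (trans (x-y≡0⇒x≡y a₀-c≡0) (sym (x-y≡0⇒x≡y a₁-c≡0)))
    where
    a₀-c≡0 : a₀ - c ≡ 0#
    a₀-c≡0 = trans h (trans (cong (_* y) a₁-c≡0) (zeroˡ y))

  HasRatio-injectiveʳ : ∀ {c y y′} → HasRatio c y → HasRatio c y′ → y ≡ y′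
  HasRatio-injectiveʳ h h′ = *-cancelˡ (a₁-c≢0 h) (trans (sym h) h′)

  HasRatio-injectiveˡ : ∀ {c c′ y} → y ≢ 1# → HasRatio c y → HasRatio c′ y → c ≡ c′
  HasRatio-injectiveˡ y≢1 h h′ = *-cancelʳ (y≢1 ∘ sym ∘ x-y≡0⇒x≡y)
    (trans (sym (Equivalence.to hasRatio⇔ h)) (Equivalence.to hasRatio⇔ h′))

  ratioPreimage : Carrier → Carrier
  ratioPreimage y = (a₀ - a₁ * y) * inv (1# - y)

  hasRatio-ratioPreimage : ∀ {y} → y ≢ 1# → HasRatio (ratioPreimage y) y
  hasRatio-ratioPreimage {y} y≢1 = Equivalence.from hasRatio⇔ (sym (begin
    ((a₀ - a₁ * y) * inv (1# - y)) * (1# - y)   ≡⟨ *-assoc _ _ _ ⟩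
    (a₀ - a₁ * y) * (inv (1# - y) * (1# - y))   ≡⟨ cong ((a₀ - a₁ * y) *_) (inv[x]*x≡1 (y≢1 ∘ sym ∘ x-y≡0⇒x≡y)) ⟩
    (a₀ - a₁ * y) * 1#                          ≡⟨ *-identityʳ _ ⟩
    a₀ - a₁ * y                                 ∎))

module NearLinearOrthogonality
    {n : ℕ} (F : FiniteField (suc n)) {g : FiniteField.Carrier F}
    (g-generator : FiniteField.IsGenerator F g)
    {d : ℕ} .{{_ : NonZero d}} (1<d : 1 < d) (d∣n : d ∣ n)
    {a : ℕ → FiniteField.Carrier F} {θ : FiniteField.Carrier F → FiniteField.Carrier F}
    (θ-cyclotomic : FiniteField.IsCyclotomicMap F d g a θ)
    (a-nearLinear : ∀ i → 1 ≤ i → i < d → a i ≡ a 1) (a₀≢a₁ : a 0 ≢ a 1) where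
  open FieldProperties F
  open RatioParametrisation F a₀≢a₁ public

  θ-minus-linear-cyclotomic : ∀ c → IsCyclotomicMap d g (λ i → a i - c) (λ x → θ x - c * x)
  θ-minus-linear-cyclotomic c =
    trans (cong₂ _-_ (proj₁ θ-cyclotomic) (zeroʳ c)) (-‿inverseʳ 0#) ,
    λ j → trans (cong (_- c * g ^ j) (proj₂ θ-cyclotomic j)) (sym ([y-z]x≈yx-zx (g ^ j) (a (j % d)) c))

  orthogonal⇔ : ∀ c → Orthogonal θ (linear c) ⇔ (∃[ t ] HasRatio c (g ^ (t ℕ.* d)))
  orthogonal⇔ c = mk⇔ (proj₂ ∘ Equivalence.to permutation⇔)
    (λ (t , h) → Equivalence.from permutation⇔ (a₁-c≢0 h , t , h))
    where
    open NearLinearPermutation F g-generator 1<d d∣n {ψ = λ x → θ x - c * x} (θ-minus-linear-cyclotomic c)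
           (λ i 1≤i i<d → cong (_- c) (a-nearLinear i 1≤i i<d))

Unique-map⁺ : ∀ {A B : Set} {f : A → B} {xs : List A} →
              (∀ {x y} → x ∈ xs → y ∈ xs → f x ≡ f y → x ≡ y) → Unique xs → Unique (map f xs)
Unique-map⁺ {xs = []}     _   []          = []
Unique-map⁺ {xs = x ∷ xs} inj (x∉xs ∷ xs!) =
  All.map⁺ (All.tabulate λ y∈xs fx≡fy → All.lookup x∉xs y∈xs (inj (here refl) (there y∈xs) fx≡fy)) ∷
  Unique-map⁺ (λ x∈ y∈ → inj (there x∈) (there y∈)) xs!

module Removal {A : Set} (_≟_ : DecidableEquality A) where

  remove : A → List A → List A
  remove x = filter (λ y → ¬? (y ≟ x))

  ∈-remove⁺ : ∀ {x y xs} → y ∈ xs → y ≢ x → y ∈ remove x xs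
  ∈-remove⁺ {x} = ∈-filter⁺ (λ y → ¬? (y ≟ x))

  ∈-remove⁻ : ∀ {x y xs} → y ∈ remove x xs → y ∈ xs × y ≢ x
  ∈-remove⁻ {x} = ∈-filter⁻ (λ y → ¬? (y ≟ x))

  remove-unique : ∀ {x xs} → Unique xs → Unique (remove x xs)
  remove-unique {x} = Unique.filter⁺ (λ y → ¬? (y ≟ x))

  length-remove : ∀ {x xs} → Unique xs → x ∈ xs → suc (length (remove x xs)) ≡ length xs
  length-remove {x} {_ ∷ xs} (x∉xs ∷ _) (here refl) = cong (suc ∘ length) (begin
    remove x (x ∷ xs)   ≡⟨ filter-reject (λ y → ¬? (y ≟ x)) (λ x≢x → x≢x refl) ⟩
    remove x xs         ≡⟨ filter-all (λ y → ¬? (y ≟ x)) (All.map ≢-sym x∉xs) ⟩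
    xs                  ∎)
  length-remove {x} {y ∷ xs} (y∉xs ∷ xs!) (there x∈xs) = begin
    suc (length (remove x (y ∷ xs)))   ≡⟨ cong (suc ∘ length) (filter-accept (λ y → ¬? (y ≟ x)) (All.lookup y∉xs x∈xs)) ⟩
    suc (suc (length (remove x xs)))   ≡⟨ cong suc (length-remove xs! x∈xs) ⟩
    suc (length xs)                    ∎

module DthPowers {n : ℕ} (F : FiniteField (suc n)) {g : FiniteField.Carrier F}
                 (g-generator : FiniteField.IsGenerator F g)
                 {d : ℕ} .{{_ : NonZero d}} (d∣n : d ∣ n) where
  open FieldProperties F
  open GeneratorPowers F g-generator

  M : ℕ
  M = quotient d∣n

  n≡M*d : n ≡ M ℕ.* d
  n≡M*d = _∣_.equality d∣n

  instance
    M-nonZero : NonZero M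
    M-nonZero = ℕ.m*n≢0⇒m≢0 M {{subst NonZero n≡M*d n-nonZero}}

  dthPowers : List Carrier
  dthPowers = applyUpTo (λ t → g ^ (t ℕ.* d)) M

  length-dthPowers : length dthPowers ≡ M
  length-dthPowers = length-applyUpTo _ M

  dthPowers-unique : Unique dthPowers
  dthPowers-unique = Unique.applyUpTo⁺₁ _ M λ i<j j<M →
    g^i≢g^j (ℕ.*-monoˡ-< d i<j) (subst (_ <_) (sym n≡M*d) (ℕ.*-monoˡ-< d j<M))

  ∈-dthPowers⁺ : ∀ t → g ^ (t ℕ.* d) ∈ dthPowers
  ∈-dthPowers⁺ t = subst (_∈ dthPowers) (sym g^td≡g^[t%M]d) (∈-applyUpTo⁺ _ (m%n<n t M))
    where
    td≡[t%M]d+[t/M]n : t ℕ.* d ≡ t % M ℕ.* d ℕ.+ t / M ℕ.* n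
    td≡[t%M]d+[t/M]n = begin
      t ℕ.* d                                  ≡⟨ cong (ℕ._* d) (m≡m%n+[m/n]*n t M) ⟩
      (t % M ℕ.+ t / M ℕ.* M) ℕ.* d            ≡⟨ ℕ.*-distribʳ-+ d (t % M) _ ⟩
      t % M ℕ.* d ℕ.+ t / M ℕ.* M ℕ.* d        ≡⟨ cong (t % M ℕ.* d ℕ.+_) (ℕ.*-assoc (t / M) M d) ⟩
      t % M ℕ.* d ℕ.+ t / M ℕ.* (M ℕ.* d)      ≡⟨ cong (λ m → t % M ℕ.* d ℕ.+ t / M ℕ.* m) n≡M*d ⟨
      t % M ℕ.* d ℕ.+ t / M ℕ.* n              ∎
    g^td≡g^[t%M]d : g ^ (t ℕ.* d) ≡ g ^ (t % M ℕ.* d)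
    g^td≡g^[t%M]d = trans (cong (g ^_) td≡[t%M]d+[t/M]n) (^-periodic g^n≡1 (t % M ℕ.* d) (t / M))

  ∈-dthPowers⁻ : ∀ {y} → y ∈ dthPowers → ∃[ t ] y ≡ g ^ (t ℕ.* d)
  ∈-dthPowers⁻ y∈ = let (t , _ , y≡g^td) = ∈-applyUpTo⁻ _ y∈ in t , y≡g^td

module OrthogonalLinearCount
    {n : ℕ} (F : FiniteField (suc n)) {g : FiniteField.Carrier F}
    (g-generator : FiniteField.IsGenerator F g)
    {d : ℕ} .{{_ : NonZero d}} (1<d : 1 < d) (d∣n : d ∣ n)
    {a : ℕ → FiniteField.Carrier F} {θ : FiniteField.Carrier F → FiniteField.Carrier F}
    (θ-orthomorphism : FiniteField.IsOrthomorphism F θ)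
    (θ-cyclotomic : FiniteField.IsCyclotomicMap F d g a θ)
    (a-nearLinear : ∀ i → 1 ≤ i → i < d → a i ≡ a 1) (a₀≢a₁ : a 0 ≢ a 1) where
  open FieldProperties F
  open NearLinearOrthogonality F g-generator 1<d d∣n {θ = θ} θ-cyclotomic a-nearLinear a₀≢a₁
  open DthPowers F g-generator d∣n public
  open Removal _≟_

  ratio₀ : ∃[ t ] HasRatio 0# (g ^ (t ℕ.* d))
  ratio₀ = Equivalence.to (orthogonal⇔ 0#) (permutation-resp-≗
    (λ x → sym (trans (cong (λ u → θ x - u) (zeroˡ x)) (x-0≡x (θ x)))) (proj₁ θ-orthomorphism))

  ratio₁ : ∃[ t ] HasRatio 1# (g ^ (t ℕ.* d))
  ratio₁ = Equivalence.to (orthogonal⇔ 1#) (permutation-resp-≗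
    (λ x → cong (λ u → θ x - u) (sym (*-identityˡ x))) (proj₂ θ-orthomorphism))

  t₀ t₁ : ℕ
  t₀ = proj₁ ratio₀
  t₁ = proj₁ ratio₁

  y₀ y₁ : Carrier
  y₀ = g ^ (t₀ ℕ.* d)
  y₁ = g ^ (t₁ ℕ.* d)

  y₀≢1 : y₀ ≢ 1#
  y₀≢1 y₀≡1 = ¬HasRatio-1 (subst (HasRatio 0#) y₀≡1 (proj₂ ratio₀))

  y₁≢1 : y₁ ≢ 1#
  y₁≢1 y₁≡1 = ¬HasRatio-1 (subst (HasRatio 1#) y₁≡1 (proj₂ ratio₁))

  y₀≢y₁ : y₀ ≢ y₁
  y₀≢y₁ y₀≡y₁ = 0≢1 (HasRatio-injectiveˡ y₀≢1 (proj₂ ratio₀) (subst (HasRatio 1#) (sym y₀≡y₁) (proj₂ ratio₁)))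

  candidates : List Carrier
  candidates = remove y₁ (remove y₀ (remove 1# dthPowers))

  ∈-candidates⁺ : ∀ {y} → y ∈ dthPowers → y ≢ 1# → y ≢ y₀ → y ≢ y₁ → y ∈ candidates
  ∈-candidates⁺ y∈ y≢1 y≢y₀ y≢y₁ = ∈-remove⁺ (∈-remove⁺ (∈-remove⁺ y∈ y≢1) y≢y₀) y≢y₁

  ∈-candidates⁻ : ∀ {y} → y ∈ candidates → y ∈ dthPowers × y ≢ 1# × y ≢ y₀ × y ≢ y₁
  ∈-candidates⁻ y∈ =
    let (y∈₂ , y≢y₁) = ∈-remove⁻ y∈
        (y∈₁ , y≢y₀) = ∈-remove⁻ y∈₂
        (y∈₀ , y≢1)  = ∈-remove⁻ y∈₁
    in y∈₀ , y≢1 , y≢y₀ , y≢y₁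

  length-candidates : length candidates ℕ.+ 3 ≡ M
  length-candidates = begin
    length candidates ℕ.+ 3              ≡⟨ ℕ.+-comm (length candidates) 3 ⟩
    suc (suc (suc (length candidates)))  ≡⟨ cong (suc ∘ suc) (length-remove unique₂ y₁∈) ⟩
    suc (suc (length removed₂))          ≡⟨ cong suc (length-remove unique₁ y₀∈) ⟩
    suc (length removed₁)                ≡⟨ length-remove dthPowers-unique (∈-dthPowers⁺ 0) ⟩
    length dthPowers                     ≡⟨ length-dthPowers ⟩
    M                                    ∎
    where
    removed₁ = remove 1# dthPowers
    removed₂ = remove y₀ removed₁
    unique₁ : Unique removed₁
    unique₁ = remove-unique dthPowers-unique
    unique₂ : Unique removed₂
    unique₂ = remove-unique unique₁
    y₀∈ : y₀ ∈ removed₁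
    y₀∈ = ∈-remove⁺ (∈-dthPowers⁺ t₀) y₀≢1
    y₁∈ : y₁ ∈ removed₂
    y₁∈ = ∈-remove⁺ (∈-remove⁺ (∈-dthPowers⁺ t₁) y₁≢1) (≢-sym y₀≢y₁)

  hasRatio-candidate : ∀ {y} → y ∈ candidates → HasRatio (ratioPreimage y) y
  hasRatio-candidate y∈ = hasRatio-ratioPreimage (proj₁ (proj₂ (∈-candidates⁻ y∈)))

  orthogonalLinear : List Carrier
  orthogonalLinear = map ratioPreimage candidates

  orthogonalLinear-unique : Unique orthogonalLinear
  orthogonalLinear-unique = Unique-map⁺
    (λ y∈ y′∈ c≡c′ → HasRatio-injectiveʳ (hasRatio-candidate y∈)
                       (subst (λ c → HasRatio c _) (sym c≡c′) (hasRatio-candidate y′∈)))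
    (remove-unique (remove-unique (remove-unique dthPowers-unique)))

  length-orthogonalLinear : length orthogonalLinear ℕ.+ 3 ≡ M
  length-orthogonalLinear = trans (cong (ℕ._+ 3) (length-map ratioPreimage candidates)) length-candidates

  orthogonalLinear⇒ : ∀ {c} → c ∈ orthogonalLinear → c ≢ 0# × c ≢ 1# × Orthogonal θ (linear c)
  orthogonalLinear⇒ {c} c∈ = c≢0 , c≢1 , Equivalence.from (orthogonal⇔ c) (t , subst (HasRatio c) y≡g^td hasRatio)
    where
    y : Carrier
    y = proj₁ (∈-map⁻ ratioPreimage c∈)
    y∈ : y ∈ candidates
    y∈ = proj₁ (proj₂ (∈-map⁻ ratioPreimage c∈))
    hasRatio : HasRatio c y
    hasRatio = subst (λ c → HasRatio c y) (sym (proj₂ (proj₂ (∈-map⁻ ratioPreimage c∈)))) (hasRatio-candidate y∈)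
    y-properties : y ∈ dthPowers × y ≢ 1# × y ≢ y₀ × y ≢ y₁
    y-properties = ∈-candidates⁻ y∈
    t : ℕ
    t = proj₁ (∈-dthPowers⁻ (proj₁ y-properties))
    y≡g^td : y ≡ g ^ (t ℕ.* d)
    y≡g^td = proj₂ (∈-dthPowers⁻ (proj₁ y-properties))
    c≢0 : c ≢ 0#
    c≢0 c≡0 = proj₁ (proj₂ (proj₂ y-properties))
      (HasRatio-injectiveʳ (subst (λ c → HasRatio c y) c≡0 hasRatio) (proj₂ ratio₀))
    c≢1 : c ≢ 1#
    c≢1 c≡1 = proj₂ (proj₂ (proj₂ y-properties))
      (HasRatio-injectiveʳ (subst (λ c → HasRatio c y) c≡1 hasRatio) (proj₂ ratio₁))

  orthogonalLinear⇐ : ∀ {c} → c ≢ 0# × c ≢ 1# × Orthogonal θ (linear c) → c ∈ orthogonalLinear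
  orthogonalLinear⇐ {c} (c≢0 , c≢1 , orthogonal) =
    subst (_∈ orthogonalLinear) (HasRatio-injectiveˡ y≢1 (hasRatio-ratioPreimage y≢1) hasRatio)
      (∈-map⁺ ratioPreimage (∈-candidates⁺ (∈-dthPowers⁺ t) y≢1 y≢y₀ y≢y₁))
    where
    t : ℕ
    t = proj₁ (Equivalence.to (orthogonal⇔ c) orthogonal)
    hasRatio : HasRatio c (g ^ (t ℕ.* d))
    hasRatio = proj₂ (Equivalence.to (orthogonal⇔ c) orthogonal)
    y≢1 : g ^ (t ℕ.* d) ≢ 1#
    y≢1 y≡1 = ¬HasRatio-1 (subst (HasRatio c) y≡1 hasRatio)
    y≢y₀ : g ^ (t ℕ.* d) ≢ y₀
    y≢y₀ y≡y₀ = c≢0 (HasRatio-injectiveˡ y₀≢1 (subst (HasRatio c) y≡y₀ hasRatio) (proj₂ ratio₀))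
    y≢y₁ : g ^ (t ℕ.* d) ≢ y₁
    y≢y₁ y≡y₁ = c≢1 (HasRatio-injectiveˡ y₁≢1 (subst (HasRatio c) y≡y₁ hasRatio) (proj₂ ratio₁))

  listsOrthogonalLinear : ListsOrthogonalLinear θ orthogonalLinear
  listsOrthogonalLinear = orthogonalLinear-unique , λ c → mk⇔ orthogonalLinear⇒ orthogonalLinear⇐

open import Data.Nat using (_+_; _*_)

theorem4p9 : (d q : ℕ) .{{_ : NonZero d}} → 2 ≤ d → IsPrimePower q → d ∣ q ∸ 1 →
    (F : FiniteField q) → (g : FiniteField.Carrier F) → FiniteField.IsGenerator F g →
    (θ : FiniteField.Carrier F → FiniteField.Carrier F) →
    FiniteField.InD F d g θ → FiniteField.NearLinear F d g θ →
    ∃[ L ] (FiniteField.ListsOrthogonalLinear F θ L × length L * d + 3 * d + 1 ≡ q)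
theorem4p9 d zero _ _ _ F _ _ _ _ _ = ⊥-elim (¬Fin0 (Inverse.to (FiniteField.card F) (FiniteField.0# F)))
theorem4p9 d (suc n) 1<d _ d∣n F g g-generator θ ((θ-orthomorphism , _) , _)
           (a , θ-cyclotomic , a₀≢a₁ , a-nearLinear) =
  orthogonalLinear , listsOrthogonalLinear , (begin
    length orthogonalLinear * d + 3 * d + 1   ≡⟨ ℕ.+-comm _ 1 ⟩
    suc (length orthogonalLinear * d + 3 * d) ≡⟨ cong suc (ℕ.*-distribʳ-+ d (length orthogonalLinear) 3) ⟨
    suc ((length orthogonalLinear + 3) * d)   ≡⟨ cong (λ m → suc (m * d)) length-orthogonalLinear ⟩
    suc (M * d)                               ≡⟨ cong suc n≡M*d ⟨
    suc n                                     ∎)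
  where
  open OrthogonalLinearCount F g-generator 1<d d∣n θ-orthomorphism θ-cyclotomic a-nearLinear a₀≢a₁
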